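{- Let $\ell\geqslant 2$, $\varepsilon\in\{+1,-1\}$ and $d\in[1,\ell-1]$. The minimum of $\mu^{(\varepsilon)}(K)$ over all $K\subset[1,\ell-1]$ with $\#K=d$ is attained only at $K=[1,d]$, and equals $\frac16 d(d+1)\big(d+\frac{7-3\varepsilon}{2}\big)$.
   Context: $[m,n]=\{x\in\mathbb Z\mid m\le x\le n\}$; an interval of $\mathbb Z$ is a non-empty set of the form $[a,b]$. For $K\subset[1,\ell-1]$, let $\mathcal I_K$ be the set of maximal intervals of $\mathbb Z$ contained in $K$, $N(K)=\sum_{I\in\mathcal I_K}\frac{\#I(\#I+1)}{2}$, and $\mu^{(\varepsilon)}(K)=\sum_{k\in K}\frac{k(k-\varepsilon)}{2}+N(K)$. -}

module Defs where

open import Data.Nat using (ℕ; zero; suc; _+_; _*_; _∸_; _/_; _≤ᵇ_; _<ᵇ_; _<?_)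
open import Data.Bool using (Bool; true; false; _∧_; not; if_then_else_)
open import Data.Fin using (Fin; toℕ; fromℕ<)
open import Data.Fin.Subset using (Subset; inside; outside)
open import Data.Vec using (lookup; tabulate)
open import Data.Sign as Sign using (Sign)
open import Relation.Nullary using (yes; no)

-- A subset K ⊆ [1, n] is represented by K : Subset n, where the index
-- i : Fin n stands for the integer toℕ i + 1.  Here n = ℓ - 1.

_∈ℕ_ : ∀ {n} → ℕ → Subset n → Bool
_∈ℕ_ zero K = false
_∈ℕ_ {n} (suc x) K with x <? n
... | yes p = lookup K (fromℕ< p)
... | no _  = false

sumTo : ℕ → (ℕ → ℕ) → ℕ
sumTo zero f = 0
sumTo (suc n) f = sumTo n f + f (suc n)

allFrom : ℕ → ℕ → (ℕ → Bool) → Bool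
allFrom a zero P = true
allFrom a (suc m) P = P a ∧ allFrom (suc a) m P

intervalIn : ∀ {n} → ℕ → ℕ → Subset n → Bool
intervalIn a b K = allFrom a (suc b ∸ a) (λ k → k ∈ℕ K)

-- [a, b] is a maximal interval of ℤ contained in K
-- (a - 1 ∉ K and b + 1 ∉ K; note 0 ∉ K and n + 1 ∉ K automatically)
isMaximalInterval : ∀ {n} → Subset n → ℕ → ℕ → Bool
isMaximalInterval K a b =
  (a ≤ᵇ b) ∧ intervalIn a b K ∧ not ((a ∸ 1) ∈ℕ K) ∧ not (suc b ∈ℕ K)

tri : ℕ → ℕ
tri m = (m * suc m) / 2

-- N(K) = Σ_{I ∈ 𝓘_K} #I (#I + 1) / 2 ; every maximal interval lies in [1, n]
N : ∀ {n} → Subset n → ℕ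
N {n} K = sumTo n (λ a → sumTo n (λ b →
  if isMaximalInterval K a b then tri (suc b ∸ a) else 0))

-- k (k - ε) / 2
term : Sign → ℕ → ℕ
term Sign.+ k = (k * (k ∸ 1)) / 2
term Sign.- k = (k * suc k) / 2

μ : ∀ {n} → Sign → Subset n → ℕ
μ {n} ε K = sumTo n (λ k → if k ∈ℕ K then term ε k else 0) + N K

initSeg : (n d : ℕ) → Subset n
initSeg n d = tabulate (λ i → toℕ i <ᵇ d)

-- (7 - 3 ε) / 2 : equals 2 for ε = +1 and 5 for ε = -1
c : Sign → ℕ
c Sign.+ = 2
c Sign.- = 5

{-# OPTIONS --safe #-}
-- Let run(k) be the number of consecutive elements of K ending at k.  A maximal
-- interval of length m contributes 1 + 2 + ⋯ + m to N(K), one summand for each of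
-- its elements, so N(K) = Σ_{k ∈ K} run(k) and μ(K) = Σ_{k ∈ K} (k(k-ε)/2 + run(k)).
-- Compare the i-th smallest element k of K with the i-th element i of [1, d]: if
-- k = i then [1, i] ⊆ K and both contribute i(i-ε)/2 + i; if k > i then already
-- k(k-ε)/2 ≥ (i+1)(i+1-ε)/2 ≥ i(i-ε)/2 + i, and run(k) ≥ 1 makes the contribution
-- of k strictly larger.  Summing, μ(K) ≥ μ([1, d]) with equality only for K = [1, d];
-- the closed form of μ([1, d]) is a sum of triangular numbers.
module Submission where

open import Defs
open import Data.Bool using (Bool; true; false; _∧_; not; if_then_else_)
open import Data.Bool.Properties using (∧-zeroʳ; ∧-identityʳ; ∧-assoc)
open import Data.Fin using (Fin; toℕ; fromℕ<)
open import Data.Fin.Properties using (toℕ<n; fromℕ<-toℕ; toℕ-fromℕ<)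
open import Data.Fin.Subset using (Subset; ∣_∣)
open import Data.Nat
open import Data.Nat.DivMod using (+-distrib-/-∣ʳ; m*n/n≡m)
open import Data.Nat.Divisibility using (divides)
open import Data.Nat.Properties
open import Data.Nat.Tactic.RingSolver using (solve-∀)
open import Data.Product using (_×_; _,_)
open import Data.Sign using (Sign)
open import Data.Sum using (inj₁; inj₂)
open import Data.Vec using ([]; _∷_; lookup)
open import Function using (_∘_)
open import Data.Vec.Properties using (tabulate∘lookup; tabulate-cong; lookup∘tabulate)
open import Relation.Binary.PropositionalEquality
open import Relation.Nullary using (¬_; yes; no; Dec; contradiction)
open import Relation.Nullary.Decidable using (dec-true; dec-false)

_when_ : ℕ → Bool → ℕ
x when b = if b then x else 0

when-+ : ∀ b x y → x when b + y when b ≡ (x + y) when b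
when-+ true  x y = refl
when-+ false x y = refl

when-0 : ∀ b → 0 when b ≡ 0
when-0 true  = refl
when-0 false = refl

when-not+when : ∀ b x → x when not b + x when b ≡ x
when-not+when true  x = refl
when-not+when false x = +-identityʳ x

when≤ : ∀ b x → x when b ≤ x
when≤ true  x = ≤-refl
when≤ false x = z≤n

∧³-zeroʳ : ∀ x y z → x ∧ y ∧ z ∧ false ≡ false
∧³-zeroʳ x y z rewrite ∧-zeroʳ z | ∧-zeroʳ y = ∧-zeroʳ x

<ᵇ-suc : ∀ m n → (m <ᵇ suc n) ≡ (m ≤ᵇ n)
<ᵇ-suc zero    n = refl
<ᵇ-suc (suc m) n = refl

sumTo-cong : ∀ n {f g : ℕ → ℕ} → (∀ k → 1 ≤ k → k ≤ n → f k ≡ g k) → sumTo n f ≡ sumTo n g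
sumTo-cong zero    f≗g = refl
sumTo-cong (suc n) f≗g =
  cong₂ _+_ (sumTo-cong n (λ k 1≤k k≤n → f≗g k 1≤k (m≤n⇒m≤1+n k≤n))) (f≗g (suc n) (s≤s z≤n) ≤-refl)

sumTo-0 : ∀ n {f : ℕ → ℕ} → (∀ k → 1 ≤ k → k ≤ n → f k ≡ 0) → sumTo n f ≡ 0
sumTo-0 zero    f≗0 = refl
sumTo-0 (suc n) f≗0 =
  cong₂ _+_ (sumTo-0 n (λ k 1≤k k≤n → f≗0 k 1≤k (m≤n⇒m≤1+n k≤n))) (f≗0 (suc n) (s≤s z≤n) ≤-refl)

sumTo-+ : ∀ n (f g : ℕ → ℕ) → sumTo n (λ k → f k + g k) ≡ sumTo n f + sumTo n g
sumTo-+ zero    f g = refl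
sumTo-+ (suc n) f g rewrite sumTo-+ n f g = interchange (sumTo n f) (sumTo n g) (f (suc n)) (g (suc n))
  where
  interchange : ∀ a b x y → a + b + (x + y) ≡ a + x + (b + y)
  interchange = solve-∀

sumTo-shift : ∀ n (f : ℕ → ℕ) → sumTo (suc n) f ≡ f 1 + sumTo n (λ k → f (suc k))
sumTo-shift zero    f = +-comm 0 (f 1)
sumTo-shift (suc n) f rewrite sumTo-shift n f = +-assoc (f 1) _ _

sumTo-single : ∀ n {f : ℕ → ℕ} t → 1 ≤ t → t ≤ n →
               (∀ k → 1 ≤ k → k ≤ n → k ≢ t → f k ≡ 0) → sumTo n f ≡ f t
sumTo-single zero    (suc t) _ () _
sumTo-single (suc n) {f} t 1≤t t≤1+n f≗0 with t ≟ suc n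
... | yes refl = cong (_+ f t) (sumTo-0 n (λ k 1≤k k≤n → f≗0 k 1≤k (m≤n⇒m≤1+n k≤n) (<⇒≢ (s≤s k≤n))))
... | no t≢1+n = begin
  sumTo n f + f (suc n) ≡⟨ cong₂ _+_ rest (f≗0 (suc n) (s≤s z≤n) ≤-refl (≢-sym t≢1+n)) ⟩
  f t + 0               ≡⟨ +-identityʳ (f t) ⟩
  f t                   ∎
  where
  open ≡-Reasoning
  rest : sumTo n f ≡ f t
  rest = sumTo-single n t 1≤t (s≤s⁻¹ (≤∧≢⇒< t≤1+n t≢1+n)) (λ k 1≤k k≤n → f≗0 k 1≤k (m≤n⇒m≤1+n k≤n))

sumTo-comm : ∀ n m (f : ℕ → ℕ → ℕ) →
             sumTo n (λ a → sumTo m (f a)) ≡ sumTo m (λ b → sumTo n (λ a → f a b))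
sumTo-comm zero    m f = sym (sumTo-0 m (λ _ _ _ → refl))
sumTo-comm (suc n) m f rewrite sumTo-comm n m f =
  sym (sumTo-+ m (λ b → sumTo n (λ a → f a b)) (f (suc n)))

tri-suc : ∀ m → tri (suc m) ≡ tri m + suc m
tri-suc m = begin
  (suc m * suc (suc m)) / 2     ≡⟨ cong (_/ 2) (expand m) ⟩
  (m * suc m + suc m * 2) / 2   ≡⟨ +-distrib-/-∣ʳ (m * suc m) (divides (suc m) refl) ⟩
  tri m + (suc m * 2) / 2       ≡⟨ cong (tri m +_) (m*n/n≡m (suc m) 2) ⟩
  tri m + suc m                 ∎
  where
  open ≡-Reasoning
  expand : ∀ m → suc m * suc (suc m) ≡ m * suc m + suc m * 2
  expand = solve-∀

tri[m]*2≡m*[1+m] : ∀ m → tri m * 2 ≡ m * suc m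
tri[m]*2≡m*[1+m] zero    = refl
tri[m]*2≡m*[1+m] (suc m) = begin
  tri (suc m) * 2               ≡⟨ cong (_* 2) (tri-suc m) ⟩
  (tri m + suc m) * 2           ≡⟨ *-distribʳ-+ 2 (tri m) (suc m) ⟩
  tri m * 2 + suc m * 2         ≡⟨ cong (_+ suc m * 2) (tri[m]*2≡m*[1+m] m) ⟩
  m * suc m + suc m * 2         ≡⟨ expand m ⟩
  suc m * suc (suc m)           ∎
  where
  open ≡-Reasoning
  expand : ∀ m → m * suc m + suc m * 2 ≡ suc m * suc (suc m)
  expand = solve-∀

term₊[k]+k≡tri[k] : ∀ k → term Sign.+ k + k ≡ tri k
term₊[k]+k≡tri[k] zero    = refl
term₊[k]+k≡tri[k] (suc k) = begin
  (suc k * k) / 2 + suc k   ≡⟨ cong (λ x → x / 2 + suc k) (*-comm (suc k) k) ⟩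
  tri k + suc k             ≡⟨ tri-suc k ⟨
  tri (suc k)               ∎
  where open ≡-Reasoning

term[k]+k≤term[1+k] : ∀ ε k → term ε k + k ≤ term ε (suc k)
term[k]+k≤term[1+k] Sign.- k = subst (tri k + k ≤_) (sym (tri-suc k)) (+-monoʳ-≤ (tri k) (n≤1+n k))
term[k]+k≤term[1+k] Sign.+ k = ≤-reflexive (begin
  term Sign.+ k + k         ≡⟨ term₊[k]+k≡tri[k] k ⟩
  tri k                     ≡⟨ cong (_/ 2) (*-comm k (suc k)) ⟩
  term Sign.+ (suc k)       ∎)
  where open ≡-Reasoning

term-mono : ∀ ε {i j} → i ≤ j → term ε i ≤ term ε j
term-mono ε {i} {j} i≤j with m≤n⇒m<n∨m≡n i≤j
... | inj₂ refl = ≤-refl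
term-mono ε {i} {suc j} _ | inj₁ i<1+j =
  ≤-trans (term-mono ε (s≤s⁻¹ i<1+j)) (≤-trans (m≤m+n (term ε j) j) (term[k]+k≤term[1+k] ε j))

cost : Sign → ℕ → ℕ → ℕ
cost ε k r = term ε k + r

segmentWeight : Sign → ℕ → ℕ
segmentWeight ε d = sumTo d (λ i → cost ε i i)

-- An element m + 1 of K preceded by only i < m elements of K costs more than the
-- element i + 1 of [1, d] does, whatever its run length l + 1.
later-element-costs-more : ∀ ε {i m} l → i < m → cost ε (suc i) (suc i) < cost ε (suc m) (suc l)
later-element-costs-more ε {i} {m} l i<m = begin-strict
  term ε (suc i) + suc i    ≤⟨ term[k]+k≤term[1+k] ε (suc i) ⟩
  term ε (suc (suc i))      ≤⟨ term-mono ε (s≤s i<m) ⟩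
  term ε (suc m)            <⟨ m<m+n (term ε (suc m)) z<s ⟩
  term ε (suc m) + suc l    ∎
  where open ≤-Reasoning

segmentWeight*6 : ∀ ε d → segmentWeight ε d * 6 ≡ d * suc d * (d + c ε)
segmentWeight*6 ε       zero    = refl
segmentWeight*6 Sign.+ (suc d) = begin
  (S + (term Sign.+ (suc d) + suc d)) * 6        ≡⟨ cong (λ t → (S + t) * 6) (term₊[k]+k≡tri[k] (suc d)) ⟩
  (S + tri (suc d)) * 6                          ≡⟨ split S (tri (suc d)) ⟩
  S * 6 + tri (suc d) * 2 * 3                    ≡⟨ cong₂ (λ x y → x + y * 3) ih (tri[m]*2≡m*[1+m] (suc d)) ⟩
  d * suc d * (d + 2) + suc d * suc (suc d) * 3  ≡⟨ collect d ⟩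
  suc d * suc (suc d) * (suc d + 2)              ∎
  where
  open ≡-Reasoning
  S = segmentWeight Sign.+ d
  ih = segmentWeight*6 Sign.+ d
  split : ∀ S t → (S + t) * 6 ≡ S * 6 + t * 2 * 3
  split = solve-∀
  collect : ∀ d → d * suc d * (d + 2) + suc d * suc (suc d) * 3 ≡ suc d * suc (suc d) * (suc d + 2)
  collect = solve-∀
segmentWeight*6 Sign.- (suc d) = begin
  (S + (tri (suc d) + suc d)) * 6                            ≡⟨ split S (tri (suc d)) d ⟩
  S * 6 + tri (suc d) * 2 * 3 + suc d * 6                    ≡⟨ cong₂ (λ x y → x + y * 3 + suc d * 6) ih
                                                                      (tri[m]*2≡m*[1+m] (suc d)) ⟩
  d * suc d * (d + 5) + suc d * suc (suc d) * 3 + suc d * 6  ≡⟨ collect d ⟩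
  suc d * suc (suc d) * (suc d + 5)                          ∎
  where
  open ≡-Reasoning
  S = segmentWeight Sign.- d
  ih = segmentWeight*6 Sign.- d
  split : ∀ S t d → (S + (t + suc d)) * 6 ≡ S * 6 + t * 2 * 3 + suc d * 6
  split = solve-∀
  collect : ∀ d → d * suc d * (d + 5) + suc d * suc (suc d) * 3 + suc d * 6
                  ≡ suc d * suc (suc d) * (suc d + 5)
  collect = solve-∀

segmentWeight-closed : ∀ ε d → segmentWeight ε d ≡ (d * suc d * (d + c ε)) / 6
segmentWeight-closed ε d = begin
  segmentWeight ε d                     ≡⟨ m*n/n≡m (segmentWeight ε d) 6 ⟨
  (segmentWeight ε d * 6) / 6           ≡⟨ cong (_/ 6) (segmentWeight*6 ε d) ⟩
  (d * suc d * (d + c ε)) / 6           ∎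
  where open ≡-Reasoning

allFrom-snoc : ∀ a m (Q : ℕ → Bool) → allFrom a (suc m) Q ≡ allFrom a m Q ∧ Q (a + m)
allFrom-snoc a zero    Q rewrite +-identityʳ a = ∧-identityʳ (Q a)
allFrom-snoc a (suc m) Q rewrite allFrom-snoc (suc a) m Q | +-suc a m = sym (∧-assoc (Q a) _ _)

module Runs (P : ℕ → Bool) where

  run : ℕ → ℕ
  run zero    = 0
  run (suc k) = if P (suc k) then suc (run k) else 0

  run-present : ∀ k → P (suc k) ≡ true → run (suc k) ≡ suc (run k)
  run-present k e = cong (λ b → if b then suc (run k) else 0) e

  run-absent : ∀ k → P k ≡ false → run k ≡ 0
  run-absent zero    e = refl
  run-absent (suc k) e = cong (λ b → if b then suc (run k) else 0) e

  run≤ : ∀ k → run k ≤ k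
  run≤ zero = z≤n
  run≤ (suc k) with P (suc k)
  ... | true  = s≤s (run≤ k)
  ... | false = z≤n

  allFrom-run : ∀ a m → allFrom (suc a) m P ≡ (m ≤ᵇ run (a + m))
  allFrom-run a zero    = refl
  allFrom-run a (suc m) rewrite allFrom-snoc (suc a) m P | allFrom-run a m | +-suc a m = extend (a + m)
    where
    extend : ∀ k → (m ≤ᵇ run k) ∧ P (suc k) ≡ (suc m ≤ᵇ run (suc k))
    extend k with P (suc k)
    ... | true  = trans (∧-identityʳ _) (sym (<ᵇ-suc m (run k)))
    ... | false = ∧-zeroʳ _

  run-exact : P 0 ≡ false → ∀ b j → (j ≤ᵇ run b) ∧ not (P (b ∸ j)) ≡ (j ≡ᵇ run b)
  run-exact P0 zero zero    rewrite P0 = refl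
  run-exact P0 zero (suc j) = refl
  run-exact P0 (suc b) zero with P (suc b)
  ... | true  = refl
  ... | false = refl
  run-exact P0 (suc b) (suc j) with P (suc b)
  ... | true  = trans (cong (_∧ not (P (b ∸ j))) (<ᵇ-suc j (run b))) (run-exact P0 b j)
  ... | false = refl

  runSum blockSum : ℕ → ℕ
  runSum   m = sumTo m (λ k → run k when P k)
  blockSum m = sumTo m (λ b → tri (run b) when (P b ∧ not (P (suc b))))

  runSum≡blockSum : ∀ m → runSum m ≡ blockSum m + tri (run m) when P (suc m)
  runSum≡blockSum zero = sym (when-0 (P 1))
  runSum≡blockSum (suc m) with P (suc m) in e
  ... | true = begin
    runSum m + suc r                                ≡⟨ cong (_+ suc r) (runSum≡blockSum m) ⟩
    B + tri r when P (suc m) + suc r                ≡⟨ cong (λ b → B + tri r when b + suc r) e ⟩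
    B + tri r + suc r                               ≡⟨ +-assoc B (tri r) (suc r) ⟩
    B + (tri r + suc r)                             ≡⟨ cong (B +_) (tri-suc r) ⟨
    B + tri (suc r)                                 ≡⟨ cong (B +_) (when-not+when Q (tri (suc r))) ⟨
    B + (tri (suc r) when not Q + tri (suc r) when Q) ≡⟨ +-assoc B _ _ ⟨
    B + tri (suc r) when not Q + tri (suc r) when Q ∎
    where
    open ≡-Reasoning
    B = blockSum m
    r = run m
    Q = P (suc (suc m))
  ... | false = begin
    runSum m + 0                                    ≡⟨ +-identityʳ (runSum m) ⟩
    runSum m                                        ≡⟨ runSum≡blockSum m ⟩
    B + tri (run m) when P (suc m)                  ≡⟨ cong (λ b → B + tri (run m) when b) e ⟩
    B + 0                                           ≡⟨ +-identityʳ (B + 0) ⟨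
    B + 0 + 0                                       ≡⟨ cong (B + 0 +_) (when-0 Q) ⟨
    B + 0 + 0 when Q                                ∎
    where
    open ≡-Reasoning
    B = blockSum m
    Q = P (suc (suc m))

  count : ℕ → ℕ
  count m = sumTo m (λ k → 1 when P k)

  weight : Sign → ℕ → ℕ
  weight ε m = sumTo m (λ k → cost ε k (run k) when P k)

  count-present : ∀ m → P (suc m) ≡ true → count (suc m) ≡ suc (count m)
  count-present m e = trans (cong (λ b → count m + 1 when b) e) (+-comm (count m) 1)

  count-absent : ∀ m → P (suc m) ≡ false → count (suc m) ≡ count m
  count-absent m e = trans (cong (λ b → count m + 1 when b) e) (+-identityʳ (count m))

  weight-present : ∀ ε m → P (suc m) ≡ true →
                   weight ε (suc m) ≡ weight ε m + cost ε (suc m) (suc (run m))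
  weight-present ε m e = cong₂ (λ b r → weight ε m + cost ε (suc m) r when b) e (run-present m e)

  weight-absent : ∀ ε m → P (suc m) ≡ false → weight ε (suc m) ≡ weight ε m
  weight-absent ε m e =
    trans (cong (λ b → weight ε m + cost ε (suc m) (run (suc m)) when b) e) (+-identityʳ (weight ε m))

  count≤ : ∀ m → count m ≤ m
  count≤ zero    = z≤n
  count≤ (suc m) = subst (count (suc m) ≤_) (+-comm m 1) (+-mono-≤ (count≤ m) (when≤ (P (suc m)) 1))

  count≡⇒run≡ : ∀ m → count m ≡ m → run m ≡ m
  count≡⇒run≡ zero    _ = refl
  count≡⇒run≡ (suc m) count≡ with P (suc m) in e
  ... | true  = cong suc (count≡⇒run≡ m (suc-injective (trans (+-comm 1 (count m)) count≡)))
  ... | false = contradiction (subst (_≤ m) (trans (sym (+-identityʳ (count m))) count≡) (count≤ m))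
                              (<-irrefl refl)

  IsPrefix : ℕ → Set
  IsPrefix m = ∀ k → k < m → P (suc k) ≡ (k <ᵇ count m)

  data WeightBound (ε : Sign) (m : ℕ) : Set where
    tight  : IsPrefix m → weight ε m ≡ segmentWeight ε (count m) → WeightBound ε m
    strict : segmentWeight ε (count m) < weight ε m → WeightBound ε m

  segmentWeight≤weight : ∀ {ε m} → WeightBound ε m → segmentWeight ε (count m) ≤ weight ε m
  segmentWeight≤weight (tight _ w≡) = ≤-reflexive (sym w≡)
  segmentWeight≤weight (strict w>) = <⇒≤ w>

  weightBound-absent : ∀ ε m → P (suc m) ≡ false → WeightBound ε m → WeightBound ε (suc m)
  weightBound-absent ε m e (tight prefix w≡) = tight extend (begin
    weight ε (suc m)                   ≡⟨ weight-absent ε m e ⟩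
    weight ε m                         ≡⟨ w≡ ⟩
    segmentWeight ε (count m)          ≡⟨ cong (segmentWeight ε) count≡ ⟨
    segmentWeight ε (count (suc m))    ∎)
    where
    open ≡-Reasoning
    count≡ = count-absent m e
    extend : IsPrefix (suc m)
    extend k k<1+m with m≤n⇒m<n∨m≡n (s≤s⁻¹ k<1+m)
    ... | inj₁ k<m  = trans (prefix k k<m) (cong (k <ᵇ_) (sym count≡))
    ... | inj₂ refl = trans e (sym (dec-false (k <? count (suc k)) (≤⇒≯ count≤k)))
      where
      count≤k : count (suc k) ≤ k
      count≤k = subst (_≤ k) (sym count≡) (count≤ k)
  weightBound-absent ε m e (strict w>) =
    strict (subst₂ _<_ (cong (segmentWeight ε) (sym (count-absent m e))) (sym (weight-absent ε m e)) w>)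

  weightBound-present : ∀ ε m → P (suc m) ≡ true → WeightBound ε m → WeightBound ε (suc m)
  weightBound-present ε m e bound with m≤n⇒m<n∨m≡n (count≤ m)
  ... | inj₁ count<m =
    strict (subst₂ _<_ (cong (segmentWeight ε) (sym (count-present m e))) (sym (weight-present ε m e))
                       (+-mono-≤-< (segmentWeight≤weight bound) (later-element-costs-more ε (run m) count<m)))
  ... | inj₂ count≡m = extend bound
    where
    segmentWeight≡ : segmentWeight ε (count (suc m)) ≡ segmentWeight ε (count m) + cost ε (suc m) (suc m)
    segmentWeight≡ = trans (cong (segmentWeight ε) (count-present m e))
                           (cong (λ j → segmentWeight ε (count m) + cost ε (suc j) (suc j)) count≡m)
    weight≡ : weight ε (suc m) ≡ weight ε m + cost ε (suc m) (suc m)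
    weight≡ = trans (weight-present ε m e)
                    (cong (λ r → weight ε m + cost ε (suc m) (suc r)) (count≡⇒run≡ m count≡m))
    extend : WeightBound ε m → WeightBound ε (suc m)
    extend (tight prefix w≡) =
      tight full (trans weight≡ (trans (cong (_+ cost ε (suc m) (suc m)) w≡) (sym segmentWeight≡)))
      where
      full : IsPrefix (suc m)
      full k k<1+m = trans present (sym (dec-true (k <? count (suc m)) (subst (k <_) count+1 k<1+m)))
        where
        count+1 : suc m ≡ count (suc m)
        count+1 = sym (trans (count-present m e) (cong suc count≡m))
        present : P (suc k) ≡ true
        present with m≤n⇒m<n∨m≡n (s≤s⁻¹ k<1+m)
        ... | inj₁ k<m  = trans (prefix k k<m) (dec-true (k <? count m) (subst (k <_) (sym count≡m) k<m))
        ... | inj₂ refl = e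
    extend (strict w>) =
      strict (subst₂ _<_ (sym segmentWeight≡) (sym weight≡) (+-monoˡ-< (cost ε (suc m) (suc m)) w>))

  weightBound : ∀ ε m → WeightBound ε m
  weightBound ε zero    = tight (λ _ ()) refl
  weightBound ε (suc m) with P (suc m) in e
  ... | true  = weightBound-present ε m e (weightBound ε m)
  ... | false = weightBound-absent ε m e (weightBound ε m)

  weight-full : ∀ ε m → (∀ k → k < m → P (suc k) ≡ true) →
                weight ε m ≡ segmentWeight ε m × count m ≡ m × run m ≡ m
  weight-full ε zero    _       = refl , refl , refl
  weight-full ε (suc m) present with weight-full ε m (λ k k<m → present k (m<n⇒m<1+n k<m))
  ... | w≡ , c≡ , r≡ = trans (weight-present ε m e) (cong₂ (λ w r → w + cost ε (suc m) (suc r)) w≡ r≡)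
                     , trans (count-present m e) (cong suc c≡)
                     , trans (run-present m e) (cong suc r≡)
    where
    e : P (suc m) ≡ true
    e = present m (n<1+n m)

  weight-gap : ∀ ε {m n} → m ≤ n → (∀ k → m ≤ k → k < n → P (suc k) ≡ false) →
               weight ε n ≡ weight ε m × count n ≡ count m
  weight-gap ε {m} {n} m≤n absent with m≤n⇒m<n∨m≡n m≤n
  ... | inj₂ refl = refl , refl
  weight-gap ε {m} {suc n} _ absent | inj₁ m<1+n
    with weight-gap ε (s≤s⁻¹ m<1+n) (λ k m≤k k<n → absent k m≤k (m<n⇒m<1+n k<n))
  ... | w≡ , c≡ = trans (weight-absent ε n e) w≡ , trans (count-absent n e) c≡
    where
    e : P (suc n) ≡ false
    e = absent n (s≤s⁻¹ m<1+n) (n<1+n n)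

  weight-initial : ∀ ε {n d} → d ≤ n → (∀ k → k < n → P (suc k) ≡ (k <ᵇ d)) →
                   weight ε n ≡ segmentWeight ε d × count n ≡ d
  weight-initial ε {n} {d} d≤n initial
    with weight-full ε d (λ k k<d → trans (initial k (<-≤-trans k<d d≤n)) (dec-true (k <? d) k<d))
       | weight-gap ε d≤n (λ k d≤k k<n → trans (initial k k<n) (dec-false (k <? d) (≤⇒≯ d≤k)))
  ... | w-full , c-full , _ | w-gap , c-gap = trans w-gap w-full , trans c-gap c-full

∈ℕ-lookup : ∀ {n} (K : Subset n) {x} (x<n : x < n) → suc x ∈ℕ K ≡ lookup K (fromℕ< x<n)
∈ℕ-lookup {n} K {x} x<n with x <? n
... | yes _   = refl
... | no x≮n = contradiction x<n x≮n

∈ℕ-out : ∀ {n} (K : Subset n) {x} → n < x → x ∈ℕ K ≡ false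
∈ℕ-out {n} K {suc x} n<1+x with x <? n
... | yes x<n = contradiction (s≤s⁻¹ n<1+x) (<⇒≱ x<n)
... | no _    = refl

∈ℕ-toℕ : ∀ {n} (K : Subset n) (i : Fin n) → suc (toℕ i) ∈ℕ K ≡ lookup K i
∈ℕ-toℕ K i = trans (∈ℕ-lookup K (toℕ<n i)) (cong (lookup K) (fromℕ<-toℕ i (toℕ<n i)))

∈ℕ-∷ : ∀ {n} x (K : Subset n) k → suc (suc k) ∈ℕ (x ∷ K) ≡ suc k ∈ℕ K
∈ℕ-∷ {n} x K k = by-cases (k <? n)
  where
  by-cases : Dec (k < n) → suc (suc k) ∈ℕ (x ∷ K) ≡ suc k ∈ℕ K
  by-cases (yes k<n) = trans (∈ℕ-lookup (x ∷ K) (s≤s k<n)) (sym (∈ℕ-lookup K k<n))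
  by-cases (no k≮n)  = trans (∈ℕ-out (x ∷ K) (s≤s (≰⇒> k≮n))) (sym (∈ℕ-out K (≰⇒> k≮n)))

∣∣≡count : ∀ {n} (K : Subset n) → ∣ K ∣ ≡ Runs.count (_∈ℕ K) n
∣∣≡count []           = refl
∣∣≡count {suc n} (x ∷ K) = begin
  ∣ x ∷ K ∣                                          ≡⟨ ∣∷∣ x ⟩
  1 when x + ∣ K ∣                                   ≡⟨ cong (1 when x +_) (∣∣≡count K) ⟩
  1 when x + sumTo n (λ k → 1 when (k ∈ℕ K))        ≡⟨ cong (1 when x +_) (sumTo-cong n tail) ⟩
  1 when x + sumTo n (λ k → 1 when (suc k ∈ℕ (x ∷ K))) ≡⟨ sumTo-shift n (λ k → 1 when (k ∈ℕ (x ∷ K))) ⟨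
  sumTo (suc n) (λ k → 1 when (k ∈ℕ (x ∷ K)))      ∎
  where
  open ≡-Reasoning
  ∣∷∣ : ∀ x → ∣ x ∷ K ∣ ≡ 1 when x + ∣ K ∣
  ∣∷∣ true  = refl
  ∣∷∣ false = refl
  tail : ∀ k → 1 ≤ k → k ≤ n → 1 when (k ∈ℕ K) ≡ 1 when (suc k ∈ℕ (x ∷ K))
  tail (suc k) _ _ = cong (1 when_) (sym (∈ℕ-∷ x K k))

∈ℕ-initSeg : ∀ n d {k} → k < n → suc k ∈ℕ initSeg n d ≡ (k <ᵇ d)
∈ℕ-initSeg n d k<n = trans (∈ℕ-lookup (initSeg n d) k<n)
  (trans (lookup∘tabulate (λ i → toℕ i <ᵇ d) (fromℕ< k<n)) (cong (_<ᵇ d) (toℕ-fromℕ< k<n)))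

initSeg-unique : ∀ n d (K : Subset n) → (∀ k → k < n → suc k ∈ℕ K ≡ (k <ᵇ d)) → K ≡ initSeg n d
initSeg-unique n d K initial =
  trans (sym (tabulate∘lookup K))
        (tabulate-cong λ i → trans (sym (∈ℕ-toℕ K i)) (initial (toℕ i) (toℕ<n i)))

module OnSubset {n} (K : Subset n) where

  open Runs (_∈ℕ K) public

  maximal-unfold : ∀ {a b} → a < b →
    isMaximalInterval K (suc a) b ≡ (b ∸ a ≤ᵇ run b) ∧ not (a ∈ℕ K) ∧ not (suc b ∈ℕ K)
  maximal-unfold {a} {b} a<b
    rewrite dec-true (a <? b) a<b | allFrom-run a (b ∸ a) | m+[n∸m]≡n (<⇒≤ a<b) = refl

  maximal-≮ : ∀ {a b} → ¬ a < b → isMaximalInterval K (suc a) b ≡ false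
  maximal-≮ {a} {b} a≮b rewrite dec-false (a <? b) a≮b = refl

  maximal-next∈ : ∀ a b → suc b ∈ℕ K ≡ true → isMaximalInterval K a b ≡ false
  maximal-next∈ a b e rewrite e = ∧³-zeroʳ (a ≤ᵇ b) (intervalIn a b K) (not ((a ∸ 1) ∈ℕ K))

  maximal-end∉ : ∀ a b → b ∈ℕ K ≡ false → isMaximalInterval K (suc a) b ≡ false
  maximal-end∉ a b e with a <? b
  ... | no a≮b = maximal-≮ a≮b
  ... | yes a<b rewrite maximal-unfold a<b | run-absent b e
                      | dec-false (b ∸ a ≤? 0) (<⇒≱ (m<n⇒0<n∸m a<b)) = refl

  maximal-ending-at : ∀ a b → b ∈ℕ K ≡ true → suc b ∈ℕ K ≡ false →
                      isMaximalInterval K (suc a) b ≡ (b ∸ a ≡ᵇ run b)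
  maximal-ending-at a zero    () _
  maximal-ending-at a (suc b) e e′ with a <? suc b
  ... | no a≮b = trans (maximal-≮ a≮b) (sym (cong₂ _≡ᵇ_ (m≤n⇒m∸n≡0 (≮⇒≥ a≮b)) (run-present b e)))
  ... | yes a<b = begin
    isMaximalInterval K (suc a) (suc b)               ≡⟨ maximal-unfold a<b ⟩
    (j ≤ᵇ R) ∧ not (a ∈ℕ K) ∧ not (suc (suc b) ∈ℕ K) ≡⟨ cong (λ x → (j ≤ᵇ R) ∧ not (a ∈ℕ K) ∧ not x) e′ ⟩
    (j ≤ᵇ R) ∧ not (a ∈ℕ K) ∧ true                   ≡⟨ cong ((j ≤ᵇ R) ∧_) (∧-identityʳ _) ⟩
    (j ≤ᵇ R) ∧ not (a ∈ℕ K)                          ≡⟨ cong (λ x → (j ≤ᵇ R) ∧ not (x ∈ℕ K)) a≡b∸j ⟩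
    (j ≤ᵇ R) ∧ not ((suc b ∸ j) ∈ℕ K)                ≡⟨ run-exact refl (suc b) j ⟩
    (j ≡ᵇ R)                                         ∎
    where
    open ≡-Reasoning
    j = suc b ∸ a
    R = run (suc b)
    a≡b∸j : a ≡ suc b ∸ j
    a≡b∸j = sym (m∸[m∸n]≡n (<⇒≤ a<b))

  intervalTerm : ℕ → ℕ → ℕ
  intervalTerm b a = tri (suc b ∸ a) when isMaximalInterval K a b

  sumTo-intervalTerm-runEnd : ∀ {b} → b ≤ n → b ∈ℕ K ≡ true → suc b ∈ℕ K ≡ false →
                          sumTo n (intervalTerm b) ≡ tri (run b)
  sumTo-intervalTerm-runEnd {zero}  _   () _
  sumTo-intervalTerm-runEnd {suc b} b≤n e e′ =
    trans (sumTo-single n (suc start) (s≤s z≤n) start<n others) at-start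
    where
    open ≡-Reasoning
    R = run (suc b)
    start = suc b ∸ R
    start<n : suc start ≤ n
    start<n = ≤-trans (s≤s (subst (λ r → suc b ∸ r ≤ b) (sym (run-present b e)) (m∸n≤m b (run b)))) b≤n
    at-start : intervalTerm (suc b) (suc start) ≡ tri R
    at-start = begin
      tri (suc b ∸ start) when isMaximalInterval K (suc start) (suc b)
        ≡⟨ cong (tri (suc b ∸ start) when_) (maximal-ending-at start (suc b) e e′) ⟩
      tri (suc b ∸ start) when (suc b ∸ start ≡ᵇ R)
        ≡⟨ cong (λ j → tri j when (j ≡ᵇ R)) (m∸[m∸n]≡n (run≤ (suc b))) ⟩
      tri R when (R ≡ᵇ R)
        ≡⟨ cong (tri R when_) (dec-true (R ≟ R) refl) ⟩
      tri R ∎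
    others : ∀ k → 1 ≤ k → k ≤ n → k ≢ suc start → intervalTerm (suc b) k ≡ 0
    others (suc a) _ _ a≢start = cong (tri (suc b ∸ a) when_)
      (trans (maximal-ending-at a (suc b) e e′) (dec-false (suc b ∸ a ≟ R) (a≢start ∘ cong suc ∘ a≡start)))
      where
      a≡start : suc b ∸ a ≡ R → a ≡ start
      a≡start j≡R = trans (sym (m∸[m∸n]≡n (<⇒≤ a<1+b))) (cong (suc b ∸_) j≡R)
        where
        a<1+b : a < suc b
        a<1+b = m∸n≢0⇒n<m (λ j≡0 → 0≢1+n (trans (sym j≡0) (trans j≡R (run-present b e))))

  sumTo-intervalTerm : ∀ b → 1 ≤ b → b ≤ n →
                      sumTo n (intervalTerm b) ≡ tri (run b) when (b ∈ℕ K ∧ not (suc b ∈ℕ K))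
  sumTo-intervalTerm b _ b≤n = by-cases (b ∈ℕ K) (suc b ∈ℕ K) refl refl
    where
    by-cases : ∀ x y → b ∈ℕ K ≡ x → suc b ∈ℕ K ≡ y →
               sumTo n (intervalTerm b) ≡ tri (run b) when (x ∧ not y)
    by-cases false _     e _  = sumTo-0 n λ { (suc a) _ _ → cong (tri (b ∸ a) when_) (maximal-end∉ a b e) }
    by-cases true  true  _ e′ = sumTo-0 n λ a _ _ → cong (tri (suc b ∸ a) when_) (maximal-next∈ a b e′)
    by-cases true  false e e′ = sumTo-intervalTerm-runEnd b≤n e e′

  N≡runSum : N K ≡ runSum n
  N≡runSum = begin
    N K                                        ≡⟨ sumTo-comm n n (λ a b → intervalTerm b a) ⟩
    sumTo n (λ b → sumTo n (intervalTerm b))   ≡⟨ sumTo-cong n sumTo-intervalTerm ⟩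
    blockSum n                                 ≡⟨ +-identityʳ (blockSum n) ⟨
    blockSum n + 0                             ≡⟨ cong (λ x → blockSum n + tri (run n) when x) n+1∉K ⟨
    blockSum n + tri (run n) when (suc n ∈ℕ K) ≡⟨ runSum≡blockSum n ⟨
    runSum n                                   ∎
    where
    open ≡-Reasoning
    n+1∉K = ∈ℕ-out K (n<1+n n)

  μ≡weight : ∀ ε → μ ε K ≡ weight ε n
  μ≡weight ε = begin
    μ ε K                                                          ≡⟨ cong (Σterm +_) N≡runSum ⟩
    Σterm + runSum n                                               ≡⟨ sumTo-+ n _ _ ⟨
    sumTo n (λ k → term ε k when (k ∈ℕ K) + run k when (k ∈ℕ K)) ≡⟨ sumTo-cong n (λ k _ _ → when-+ (k ∈ℕ K) _ _) ⟩
    weight ε n                                                     ∎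
    where
    open ≡-Reasoning
    Σterm = sumTo n (λ k → term ε k when (k ∈ℕ K))

  segmentWeight≤μ : ∀ ε {d} → ∣ K ∣ ≡ d → segmentWeight ε d ≤ μ ε K
  segmentWeight≤μ ε refl = subst₂ _≤_ (cong (segmentWeight ε) (sym (∣∣≡count K))) (sym (μ≡weight ε))
                                      (segmentWeight≤weight (weightBound ε n))

  μ≡segmentWeight⇒initSeg : ∀ ε {d} → ∣ K ∣ ≡ d → μ ε K ≡ segmentWeight ε d → K ≡ initSeg n d
  μ≡segmentWeight⇒initSeg ε refl μ≡ with weightBound ε n
  ... | tight prefix _ =
    initSeg-unique n ∣ K ∣ K (λ k k<n → trans (prefix k k<n) (cong (k <ᵇ_) (sym (∣∣≡count K))))
  ... | strict w> = contradiction w> (≤⇒≯ (≤-reflexive (begin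
    weight ε n                       ≡⟨ μ≡weight ε ⟨
    μ ε K                            ≡⟨ μ≡ ⟩
    segmentWeight ε ∣ K ∣            ≡⟨ cong (segmentWeight ε) (∣∣≡count K) ⟩
    segmentWeight ε (count n)        ∎)))
    where open ≡-Reasoning

initSeg-weight : ∀ ε {n d} → d ≤ n → μ ε (initSeg n d) ≡ segmentWeight ε d × ∣ initSeg n d ∣ ≡ d
initSeg-weight ε {n} {d} d≤n
  with OnSubset.weight-initial (initSeg n d) ε d≤n (λ k k<n → ∈ℕ-initSeg n d k<n)
... | w≡ , c≡ = trans (OnSubset.μ≡weight (initSeg n d) ε) w≡ , trans (∣∣≡count (initSeg n d)) c≡

lemma2p25 : (ℓ : ℕ) → 2 ≤ ℓ → (ε : Sign) → (d : ℕ) → 1 ≤ d → d ≤ ℓ ∸ 1 →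
    (∣ initSeg (ℓ ∸ 1) d ∣ ≡ d)
    × ((K : Subset (ℓ ∸ 1)) → ∣ K ∣ ≡ d → μ ε (initSeg (ℓ ∸ 1) d) ≤ μ ε K)
    × ((K : Subset (ℓ ∸ 1)) → ∣ K ∣ ≡ d → μ ε K ≡ μ ε (initSeg (ℓ ∸ 1) d) → K ≡ initSeg (ℓ ∸ 1) d)
    × (μ ε (initSeg (ℓ ∸ 1) d) ≡ (d * suc d * (d + c ε)) / 6)
lemma2p25 ℓ _ ε d _ d≤n with initSeg-weight ε d≤n
... | μI≡ , ∣I∣≡d =
    ∣I∣≡d
  , (λ K ∣K∣≡d → subst (_≤ μ ε K) (sym μI≡) (OnSubset.segmentWeight≤μ K ε ∣K∣≡d))
  , (λ K ∣K∣≡d μK≡μI → OnSubset.μ≡segmentWeight⇒initSeg K ε ∣K∣≡d (trans μK≡μI μI≡))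
  , trans μI≡ (segmentWeight-closed ε d)
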